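{- For all integers $a \geq 2$ and $n \geq 2$, we have $G_{n,a} \equiv 1 - \frac{n}{2} a \pmod{a}$.
   Context: For an integer $a \geq 2$, the generalized Genocchi numbers $G_{n,a}$ ($n \geq 0$) are defined by $$\frac{a t}{e^{(a-1)t} + e^{(a-2)t} + \dots + e^t + 1} = \sum_{n=0}^{\infty} G_{n,a} \frac{t^n}{n!}.$$ Congruences are extended to rationals: for $x, y \in \mathbb{Q}$ and a positive integer $m$, $x \equiv y \pmod{m}$ means that the numerator of the reduced fraction $x - y$ is a multiple of $m$ (equivalently, $\vartheta_p(x-y) \geq \vartheta_p(m)$ for every prime $p \mid m$, where $\vartheta_p$ is the $p$-adic valuation). -}

module Defs where

open import Data.Nat as ℕ using (ℕ; zero; suc; _∸_; _^_)
open import Data.Nat.Combinatorics using (_C_)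
open import Data.Integer as ℤ using (ℤ; +_)
open import Data.Integer.Divisibility using () renaming (_∣_ to _∣ℤ_)
open import Data.Rational using (ℚ; _+_; _*_; _-_; _/_; 0ℚ; ↥_)

ι : ℕ → ℚ
ι k = + k / 1

sumTo : ℕ → (ℕ → ℚ) → ℚ
sumTo zero    f = f 0
sumTo (suc n) f = sumTo n f + f (suc n)

sumBelow : ℕ → (ℕ → ℕ) → ℕ
sumBelow zero    f = 0
sumBelow (suc a) f = sumBelow a f ℕ.+ f a

-- Exponential formal power series are represented by their coefficient
-- sequences u, standing for  Σ u n · t^n / n! .
EGF : Set
EGF = ℕ → ℚ

-- product of exponential generating functions:
-- (Σ u n t^n/n!)(Σ v n t^n/n!) = Σ (Σ_j C(n,j) u j v (n-j)) t^n/n!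
_⋆_ : EGF → EGF → EGF
(u ⋆ v) n = sumTo n (λ j → ι (n C j) * (u j * v (n ∸ j)))

-- e^{(a-1)t} + ... + e^t + 1 = Σ_n (Σ_{k=0}^{a-1} k^n) t^n/n!   (0^0 = 1)
expSum : ℕ → EGF
expSum a n = ι (sumBelow a (λ k → k ^ n))

linear : ℕ → EGF
linear a (suc zero) = ι a
linear a _          = 0ℚ

-- G is the EGF of  a t / (e^{(a-1)t} + ... + e^t + 1),
-- i.e.  (Σ G n t^n/n!) · (e^{(a-1)t} + ... + 1) = a t  as formal power series.
-- (The constant term of the denominator is a ≠ 0, so G is uniquely determined.)
IsGenocchi : ℕ → (ℕ → ℚ) → Set
IsGenocchi a G = ∀ n → (G ⋆ expSum a) n ≡ linear a n
  where open import Relation.Binary.PropositionalEquality using (_≡_)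

_≡_[mod_] : ℚ → ℚ → ℕ → Set
x ≡ y [mod m ] = (+ m) ∣ℤ (↥ (x - y))

{-# OPTIONS --safe #-}
-- Multiplying the defining identity by e^t − 1 turns the denominator into e^{at} − 1 = a t κ(t), where
-- κ(t) = Σ a^n t^n / (n+1)!, and cancelling a t leaves G(t) κ(t) = e^t − 1.  Reading off coefficients,
-- G_0 = 0 and G_N = 1 − Σ_{j<N} C(N,j) G_j a^{N−j}/(N−j+1) for N ≥ 1.  Work in ℤ₍a₎, the rationals
-- whose denominator is coprime to a: a^k/(k+1) lies in ℤ₍a₎ (k+1 divides a^e v for some v coprime
-- to a and some e with 2^e ≤ k+1, so e ≤ k), hence every G_j lies in ℤ₍a₎, and for k ≥ 2 the
-- coefficient a^k/(k+1) lies in aℤ₍a₎.  So modulo aℤ₍a₎ only the term j = N−1 survives, giving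
-- G_N ≡ 1 − N G_{N−1} a/2, and induction yields G_N ≡ 1 − N a/2 because N (N−1) (a/2)² =
-- a · (N (N−1)/2) · a/2 lies in aℤ₍a₎.
module Submission where

open import Defs
open import Data.Integer as ℤ using (ℤ; +_)
open import Data.Integer.Divisibility using () renaming (_∣_ to _∣ℤ_)
import Data.Integer.Properties as ℤP
open import Data.Integer.Tactic.RingSolver using () renaming (solve-∀ to ℤ-solve-∀)
open import Data.Nat as ℕ using (ℕ; zero; suc; _∸_; _^_; _≤_; _<_; _≥_; z≤n; s≤s)
open import Data.Nat.Combinatorics
  using (_C_; nCn≡1; nC1≡n; nCk≡nC[n∸k]; k>n⇒nCk≡0; nCk+nC[k+1]≡[n+1]C[k+1])
open import Data.Nat.Coprimality as Coprimality using (Coprime)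
open import Data.Nat.Divisibility as ℕ∣ using (_∣_; divides)
open import Data.Nat.GCD using (gcd; gcd[m,n]∣m; gcd[m,n]∣n; gcd[m,n]≢0)
open import Data.Nat.Induction using (<-rec)
import Data.Nat.Properties as ℕP
open import Data.Nat.Tactic.RingSolver using () renaming (solve-∀ to ℕ-solve-∀)
open import Data.Product using (∃; ∃₂; _×_; _,_)
open import Data.Rational as ℚ using (ℚ; _+_; _*_; _-_; _/_; -_; 0ℚ; 1ℚ; ↥_; mkℚ; toℚᵘ)
import Data.Rational.Properties as ℚP
import Data.Rational.Unnormalised as ℚᵘ
import Data.Rational.Unnormalised.Properties as ℚᵘP
open import Data.Sum using (inj₁)
open import Function using (_∘_; const)
open import Level using (0ℓ)
open import Relation.Binary.PropositionalEquality
open import Relation.Nullary using (yes; no)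
open import Relation.Nullary.Decidable using (dec⇒maybe)
open import Tactic.RingSolver using (solve-∀)
open import Tactic.RingSolver.Core.AlmostCommutativeRing
  using (AlmostCommutativeRing; fromCommutativeRing)

ℚ-ring : AlmostCommutativeRing 0ℓ 0ℓ
ℚ-ring = fromCommutativeRing ℚP.+-*-commutativeRing (λ x → dec⇒maybe (0ℚ ℚP.≟ x))

fromℤ : ℤ → ℚ
fromℤ z = z / 1

toℚᵘ-fromℤ : ∀ z → toℚᵘ (fromℤ z) ℚᵘ.≃ ℚᵘ.mkℚᵘ z 0
toℚᵘ-fromℤ z = ℚP.toℚᵘ-fromℚᵘ (ℚᵘ.mkℚᵘ z 0)

fromℤ-homo-+ : ∀ x y → fromℤ (x ℤ.+ y) ≡ fromℤ x + fromℤ y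
fromℤ-homo-+ x y = ℚP.toℚᵘ-injective (begin
  toℚᵘ (fromℤ (x ℤ.+ y))              ≈⟨ toℚᵘ-fromℤ (x ℤ.+ y) ⟩
  ℚᵘ.mkℚᵘ (x ℤ.+ y) 0                 ≈⟨ ℚᵘ.*≡* (cross x y) ⟩
  ℚᵘ.mkℚᵘ x 0 ℚᵘ.+ ℚᵘ.mkℚᵘ y 0        ≈⟨ ℚᵘP.+-cong (toℚᵘ-fromℤ x) (toℚᵘ-fromℤ y) ⟨
  toℚᵘ (fromℤ x) ℚᵘ.+ toℚᵘ (fromℤ y)  ≈⟨ ℚP.toℚᵘ-homo-+ (fromℤ x) (fromℤ y) ⟨
  toℚᵘ (fromℤ x + fromℤ y)            ∎)
  where
  open ℚᵘP.≃-Reasoning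
  cross : ∀ x y → (x ℤ.+ y) ℤ.* (+ 1 ℤ.* + 1) ≡ (x ℤ.* + 1 ℤ.+ y ℤ.* + 1) ℤ.* + 1
  cross = ℤ-solve-∀

fromℤ-homo-* : ∀ x y → fromℤ (x ℤ.* y) ≡ fromℤ x * fromℤ y
fromℤ-homo-* x y = ℚP.toℚᵘ-injective (begin
  toℚᵘ (fromℤ (x ℤ.* y))              ≈⟨ toℚᵘ-fromℤ (x ℤ.* y) ⟩
  ℚᵘ.mkℚᵘ (x ℤ.* y) 0                 ≈⟨ ℚᵘ.*≡* (cross x y) ⟩
  ℚᵘ.mkℚᵘ x 0 ℚᵘ.* ℚᵘ.mkℚᵘ y 0        ≈⟨ ℚᵘP.*-cong (toℚᵘ-fromℤ x) (toℚᵘ-fromℤ y) ⟨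
  toℚᵘ (fromℤ x) ℚᵘ.* toℚᵘ (fromℤ y)  ≈⟨ ℚP.toℚᵘ-homo-* (fromℤ x) (fromℤ y) ⟨
  toℚᵘ (fromℤ x * fromℤ y)            ∎)
  where
  open ℚᵘP.≃-Reasoning
  cross : ∀ x y → (x ℤ.* y) ℤ.* (+ 1 ℤ.* + 1) ≡ (x ℤ.* y) ℤ.* + 1
  cross = ℤ-solve-∀

fromℤ-injective : ∀ {x y} → fromℤ x ≡ fromℤ y → x ≡ y
fromℤ-injective {x} {y} eq with ℚᵘP.≃-trans (ℚᵘP.≃-sym (toℚᵘ-fromℤ x))
                                  (ℚᵘP.≃-trans (ℚᵘP.≃-reflexive (cong toℚᵘ eq)) (toℚᵘ-fromℤ y))
... | ℚᵘ.*≡* x*1≡y*1 = trans (sym (ℤP.*-identityʳ x)) (trans x*1≡y*1 (ℤP.*-identityʳ y))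

ι-homo-+ : ∀ m n → ι (m ℕ.+ n) ≡ ι m + ι n
ι-homo-+ m n = fromℤ-homo-+ (+ m) (+ n)

ι-homo-* : ∀ m n → ι (m ℕ.* n) ≡ ι m * ι n
ι-homo-* m n = trans (cong fromℤ (ℤP.pos-* m n)) (fromℤ-homo-* (+ m) (+ n))

ι-nonZero : ∀ n .{{_ : ℕ.NonZero n}} → ι n ≢ 0ℚ
ι-nonZero (suc n) ι[1+n]≡0 = ℕP.1+n≢0 (ℤP.+-injective (fromℤ-injective {+ suc n} {+ 0} ι[1+n]≡0))

1/ℕ : (d : ℕ) .{{_ : ℕ.NonZero d}} → ℚ
1/ℕ d = + 1 / d

+/≡ι*1/ℕ : ∀ n d .{{_ : ℕ.NonZero d}} → + n / d ≡ ι n * 1/ℕ d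
+/≡ι*1/ℕ n d@(suc d-1) = ℚP.toℚᵘ-injective (begin
  toℚᵘ (+ n / d)                           ≈⟨ ℚP.toℚᵘ-fromℚᵘ (ℚᵘ.mkℚᵘ (+ n) d-1) ⟩
  ℚᵘ.mkℚᵘ (+ n) d-1                        ≈⟨ ℚᵘ.*≡* (cross (+ n) (+ d)) ⟩
  ℚᵘ.mkℚᵘ (+ n) 0 ℚᵘ.* ℚᵘ.mkℚᵘ (+ 1) d-1   ≈⟨ ℚᵘP.*-cong (toℚᵘ-fromℤ (+ n)) (ℚP.toℚᵘ-fromℚᵘ _) ⟨
  toℚᵘ (ι n) ℚᵘ.* toℚᵘ (1/ℕ d)             ≈⟨ ℚP.toℚᵘ-homo-* (ι n) (1/ℕ d) ⟨
  toℚᵘ (ι n * 1/ℕ d)                       ∎)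
  where
  open ℚᵘP.≃-Reasoning
  cross : ∀ n d → n ℤ.* (+ 1 ℤ.* d) ≡ (n ℤ.* + 1) ℤ.* d
  cross = ℤ-solve-∀

ι*1/ℕ : ∀ d .{{_ : ℕ.NonZero d}} → ι d * 1/ℕ d ≡ 1ℚ
ι*1/ℕ d@(suc d-1) = trans (sym (+/≡ι*1/ℕ d d)) (ℚP.toℚᵘ-injective (begin
  toℚᵘ (+ d / d)       ≈⟨ ℚP.toℚᵘ-fromℚᵘ (ℚᵘ.mkℚᵘ (+ d) d-1) ⟩
  ℚᵘ.mkℚᵘ (+ d) d-1    ≈⟨ ℚᵘ.*≡* (ℤP.*-comm (+ d) (+ 1)) ⟩
  toℚᵘ 1ℚ              ∎))
  where open ℚᵘP.≃-Reasoning

*-cancelˡ : ∀ c {x y} → c ≢ 0ℚ → c * x ≡ c * y → x ≡ y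
*-cancelˡ c {x} {y} c≢0 cx≡cy = begin
  x                   ≡⟨ ℚP.*-identityˡ x ⟨
  1ℚ * x              ≡⟨ cong (_* x) (ℚP.*-inverseˡ c) ⟨
  ℚ.1/ c * c * x      ≡⟨ ℚP.*-assoc (ℚ.1/ c) c x ⟩
  ℚ.1/ c * (c * x)    ≡⟨ cong (ℚ.1/ c *_) cx≡cy ⟩
  ℚ.1/ c * (c * y)    ≡⟨ ℚP.*-assoc (ℚ.1/ c) c y ⟨
  ℚ.1/ c * c * y      ≡⟨ cong (_* y) (ℚP.*-inverseˡ c) ⟩
  1ℚ * y              ≡⟨ ℚP.*-identityˡ y ⟩
  y                   ∎
  where
  open ≡-Reasoning
  instance _ = ℚ.≢-nonZero c≢0

sumTo-cong : ∀ n {f g} → (∀ j → j ≤ n → f j ≡ g j) → sumTo n f ≡ sumTo n g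
sumTo-cong zero    f≡g = f≡g 0 z≤n
sumTo-cong (suc n) f≡g =
  cong₂ _+_ (sumTo-cong n (λ j j≤n → f≡g j (ℕP.m≤n⇒m≤1+n j≤n))) (f≡g (suc n) ℕP.≤-refl)

sumTo-distrib-+ : ∀ n f g → sumTo n (λ j → f j + g j) ≡ sumTo n f + sumTo n g
sumTo-distrib-+ zero    f g = refl
sumTo-distrib-+ (suc n) f g =
  trans (cong (_+ (f (suc n) + g (suc n))) (sumTo-distrib-+ n f g))
        (interchange (sumTo n f) (sumTo n g) (f (suc n)) (g (suc n)))
  where
  interchange : ∀ a b c d → a + b + (c + d) ≡ a + c + (b + d)
  interchange = solve-∀ ℚ-ring

*-distribˡ-sumTo : ∀ n c f → c * sumTo n f ≡ sumTo n (λ j → c * f j)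
*-distribˡ-sumTo zero    c f = refl
*-distribˡ-sumTo (suc n) c f =
  trans (ℚP.*-distribˡ-+ c (sumTo n f) (f (suc n))) (cong (_+ c * f (suc n)) (*-distribˡ-sumTo n c f))

sumTo-suc : ∀ n f → sumTo (suc n) f ≡ f 0 + sumTo n (f ∘ suc)
sumTo-suc zero    f = refl
sumTo-suc (suc n) f =
  trans (cong (_+ f (suc (suc n))) (sumTo-suc n f)) (ℚP.+-assoc (f 0) (sumTo n (f ∘ suc)) (f (suc (suc n))))

sumTo-zero : ∀ n {f} → (∀ j → j ≤ n → f j ≡ 0ℚ) → sumTo n f ≡ 0ℚ
sumTo-zero n f≡0 = trans (sumTo-cong n f≡0) (sumTo-const n)
  where
  sumTo-const : ∀ n → sumTo n (const 0ℚ) ≡ 0ℚ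
  sumTo-const zero    = refl
  sumTo-const (suc n) = cong (_+ 0ℚ) (sumTo-const n)

sumTo-closed : ∀ (P : ℚ → Set) → (∀ {p q} → P p → P q → P (p + q)) →
               ∀ n {f} → (∀ j → j ≤ n → P (f j)) → P (sumTo n f)
sumTo-closed P _ zero    P[f] = P[f] 0 z≤n
sumTo-closed P P-+ (suc n) P[f] =
  P-+ (sumTo-closed P P-+ n (λ j j≤n → P[f] j (ℕP.m≤n⇒m≤1+n j≤n))) (P[f] (suc n) ℕP.≤-refl)

-- Exponential generating functions

infixl 6 _⊕_ _⊖_
infixl 7 _·_

_⊕_ : EGF → EGF → EGF
(u ⊕ v) n = u n + v n

_⊖_ : EGF → EGF → EGF
(u ⊖ v) n = u n - v n

_·_ : ℚ → EGF → EGF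
(c · u) n = c * u n

∂ : EGF → EGF
∂ u n = u (suc n)

exp : ℕ → EGF
exp c n = ι (c ^ n)

-- 0 ^ 0 = 1, so this is the unit series 1 + 0 t + 0 t² + ⋯
δ : EGF
δ = exp 0

∂-δ : ∂ δ ≗ const 0ℚ
∂-δ _ = refl

∂-exp : ∀ c → ∂ (exp c) ≗ ι c · exp c
∂-exp c n = ι-homo-* c (c ^ n)

⋆-at-0 : ∀ u v → (u ⋆ v) 0 ≡ u 0 * v 0
⋆-at-0 u v = ℚP.*-identityˡ (u 0 * v 0)

⋆-cong : ∀ {u u′ v v′} → u ≗ u′ → v ≗ v′ → u ⋆ v ≗ u′ ⋆ v′
⋆-cong u≗u′ v≗v′ n =
  sumTo-cong n (λ j _ → cong₂ (λ x y → ι (n C j) * (x * y)) (u≗u′ j) (v≗v′ (n ∸ j)))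

⋆-congˡ : ∀ {u u′} v → u ≗ u′ → u ⋆ v ≗ u′ ⋆ v
⋆-congˡ v u≗u′ = ⋆-cong {v = v} {v′ = v} u≗u′ (λ _ → refl)

⋆-congʳ : ∀ u {v v′} → v ≗ v′ → u ⋆ v ≗ u ⋆ v′
⋆-congʳ u = ⋆-cong {u = u} {u′ = u} (λ _ → refl)

⋆-distribˡ-⊕ : ∀ u v w → u ⋆ (v ⊕ w) ≗ u ⋆ v ⊕ u ⋆ w
⋆-distribˡ-⊕ u v w n =
  trans (sumTo-cong n (λ j _ → expand (ι (n C j)) (u j) (v (n ∸ j)) (w (n ∸ j)))) (sumTo-distrib-+ n _ _)
  where
  expand : ∀ k x y z → k * (x * (y + z)) ≡ k * (x * y) + k * (x * z)
  expand = solve-∀ ℚ-ring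

⋆-scalarʳ : ∀ u c v → u ⋆ (c · v) ≗ c · (u ⋆ v)
⋆-scalarʳ u c v n =
  trans (sumTo-cong n (λ j _ → pull (ι (n C j)) (u j) c (v (n ∸ j)))) (sym (*-distribˡ-sumTo n c _))
  where
  pull : ∀ k x c y → k * (x * (c * y)) ≡ c * (k * (x * y))
  pull = solve-∀ ℚ-ring

⋆-distribˡ-⊖ : ∀ u v w → u ⋆ (v ⊖ w) ≗ u ⋆ v ⊖ u ⋆ w
⋆-distribˡ-⊖ u v w n = begin
  (u ⋆ (v ⊖ w)) n                     ≡⟨ ⋆-congʳ u (λ m → minus-as-scalar (v m) (w m)) n ⟩
  (u ⋆ (v ⊕ (- 1ℚ) · w)) n            ≡⟨ ⋆-distribˡ-⊕ u v ((- 1ℚ) · w) n ⟩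
  (u ⋆ v) n + (u ⋆ ((- 1ℚ) · w)) n    ≡⟨ cong (_+_ ((u ⋆ v) n)) (⋆-scalarʳ u (- 1ℚ) w n) ⟩
  (u ⋆ v) n + (- 1ℚ) * (u ⋆ w) n      ≡⟨ minus-as-scalar ((u ⋆ v) n) ((u ⋆ w) n) ⟨
  (u ⋆ v) n - (u ⋆ w) n               ∎
  where
  open ≡-Reasoning
  minus-as-scalar : ∀ x y → x - y ≡ x + (- 1ℚ) * y
  minus-as-scalar = solve-∀ ℚ-ring

⋆-zeroˡ : ∀ u → const 0ℚ ⋆ u ≗ const 0ℚ
⋆-zeroˡ u n = sumTo-zero n λ j _ →
  trans (cong (ι (n C j) *_) (ℚP.*-zeroˡ (u (n ∸ j)))) (ℚP.*-zeroʳ (ι (n C j)))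

-- Pascal's rule C(n+1, j+1) = C(n, j) + C(n, j+1) makes ∂ a derivation for ⋆.
⋆-leibniz : ∀ u v → ∂ (u ⋆ v) ≗ ∂ u ⋆ v ⊕ u ⋆ ∂ v
⋆-leibniz u v n = begin
  sumTo (suc n) F                    ≡⟨ sumTo-suc n F ⟩
  F 0 + sumTo n (F ∘ suc)            ≡⟨ cong (_+_ (F 0)) (sumTo-cong n (λ j _ → pascal j)) ⟩
  F 0 + sumTo n (λ j → L j + R j)    ≡⟨ cong (_+_ (F 0)) (sumTo-distrib-+ n L R) ⟩
  F 0 + (sumTo n L + sumTo n R)      ≡⟨ swap (F 0) (sumTo n L) (sumTo n R) ⟩
  sumTo n L + (F 0 + sumTo n R)      ≡⟨ cong (_+_ (sumTo n L)) reindex ⟩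
  (∂ u ⋆ v) n + (u ⋆ ∂ v) n          ∎
  where
  open ≡-Reasoning
  F L R R′ : ℕ → ℚ
  F j = ι (suc n C j) * (u j * v (suc n ∸ j))
  L j = ι (n C j) * (u (suc j) * v (n ∸ j))
  R j = ι (n C suc j) * (u (suc j) * v (n ∸ j))
  R′ zero    = F 0
  R′ (suc j) = R j

  pascal : ∀ j → F (suc j) ≡ L j + R j
  pascal j = begin
    ι (suc n C suc j) * x             ≡⟨ cong (λ c → ι c * x) (nCk+nC[k+1]≡[n+1]C[k+1] n j) ⟨
    ι (n C j ℕ.+ n C suc j) * x       ≡⟨ cong (_* x) (ι-homo-+ (n C j) (n C suc j)) ⟩
    (ι (n C j) + ι (n C suc j)) * x   ≡⟨ ℚP.*-distribʳ-+ x (ι (n C j)) (ι (n C suc j)) ⟩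
    L j + R j                         ∎
    where x = u (suc j) * v (n ∸ j)

  R′≡∂-summand : ∀ j → j ≤ n → R′ j ≡ ι (n C j) * (u j * v (suc (n ∸ j)))
  R′≡∂-summand zero    _   = refl
  R′≡∂-summand (suc j) j<n = cong (λ k → ι (n C suc j) * (u (suc j) * v k)) (ℕP.+-∸-assoc 1 j<n)

  R-last : R n ≡ 0ℚ
  R-last = trans (cong (λ c → ι c * y) (k>n⇒nCk≡0 (ℕP.n<1+n n))) (ℚP.*-zeroˡ y)
    where y = u (suc n) * v (n ∸ n)

  reindex : F 0 + sumTo n R ≡ (u ⋆ ∂ v) n
  reindex = begin
    F 0 + sumTo n R          ≡⟨ sumTo-suc n R′ ⟨
    sumTo n R′ + R n         ≡⟨ cong₂ _+_ (sumTo-cong n R′≡∂-summand) R-last ⟩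
    (u ⋆ ∂ v) n + 0ℚ         ≡⟨ ℚP.+-identityʳ _ ⟩
    (u ⋆ ∂ v) n              ∎

  swap : ∀ a b c → a + (b + c) ≡ b + (a + c)
  swap = solve-∀ ℚ-ring

⋆-comm : ∀ u v → u ⋆ v ≗ v ⋆ u
⋆-comm u v zero    = trans (⋆-at-0 u v) (trans (ℚP.*-comm (u 0) (v 0)) (sym (⋆-at-0 v u)))
⋆-comm u v (suc n) = begin
  (u ⋆ v) (suc n)              ≡⟨ ⋆-leibniz u v n ⟩
  (∂ u ⋆ v) n + (u ⋆ ∂ v) n    ≡⟨ cong₂ _+_ (⋆-comm (∂ u) v n) (⋆-comm u (∂ v) n) ⟩
  (v ⋆ ∂ u) n + (∂ v ⋆ u) n    ≡⟨ ℚP.+-comm ((v ⋆ ∂ u) n) ((∂ v ⋆ u) n) ⟩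
  (∂ v ⋆ u) n + (v ⋆ ∂ u) n    ≡⟨ ⋆-leibniz v u n ⟨
  (v ⋆ u) (suc n)              ∎
  where open ≡-Reasoning

⋆-distribʳ-⊕ : ∀ u v w → (v ⊕ w) ⋆ u ≗ v ⋆ u ⊕ w ⋆ u
⋆-distribʳ-⊕ u v w n =
  trans (⋆-comm (v ⊕ w) u n) (trans (⋆-distribˡ-⊕ u v w n) (cong₂ _+_ (⋆-comm u v n) (⋆-comm u w n)))

⋆-scalarˡ : ∀ u c v → (c · v) ⋆ u ≗ c · (v ⋆ u)
⋆-scalarˡ u c v n = trans (⋆-comm (c · v) u n) (trans (⋆-scalarʳ u c v n) (cong (c *_) (⋆-comm u v n)))

⋆-assoc : ∀ u v w → (u ⋆ v) ⋆ w ≗ u ⋆ (v ⋆ w)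
⋆-assoc u v w zero =
  trans (⋆-at-0 (u ⋆ v) w) (trans (cong (_* w 0) (⋆-at-0 u v)) (trans (ℚP.*-assoc (u 0) (v 0) (w 0))
    (trans (cong (u 0 *_) (sym (⋆-at-0 v w))) (sym (⋆-at-0 u (v ⋆ w))))))
⋆-assoc u v w (suc n) = begin
  ((u ⋆ v) ⋆ w) (suc n)                                       ≡⟨ ⋆-leibniz (u ⋆ v) w n ⟩
  (∂ (u ⋆ v) ⋆ w) n + ((u ⋆ v) ⋆ ∂ w) n                       ≡⟨ cong (_+ ((u ⋆ v) ⋆ ∂ w) n) expand-left ⟩
  ((∂ u ⋆ v) ⋆ w) n + ((u ⋆ ∂ v) ⋆ w) n + ((u ⋆ v) ⋆ ∂ w) n
    ≡⟨ cong₂ _+_ (cong₂ _+_ (⋆-assoc (∂ u) v w n) (⋆-assoc u (∂ v) w n)) (⋆-assoc u v (∂ w) n) ⟩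
  (∂ u ⋆ (v ⋆ w)) n + (u ⋆ (∂ v ⋆ w)) n + (u ⋆ (v ⋆ ∂ w)) n   ≡⟨ ℚP.+-assoc ((∂ u ⋆ (v ⋆ w)) n) _ _ ⟩
  (∂ u ⋆ (v ⋆ w)) n + ((u ⋆ (∂ v ⋆ w)) n + (u ⋆ (v ⋆ ∂ w)) n) ≡⟨ cong (_+_ ((∂ u ⋆ (v ⋆ w)) n)) collect-right ⟩
  (∂ u ⋆ (v ⋆ w)) n + (u ⋆ ∂ (v ⋆ w)) n                       ≡⟨ ⋆-leibniz u (v ⋆ w) n ⟨
  (u ⋆ (v ⋆ w)) (suc n)                                       ∎
  where
  open ≡-Reasoning
  expand-left : (∂ (u ⋆ v) ⋆ w) n ≡ ((∂ u ⋆ v) ⋆ w) n + ((u ⋆ ∂ v) ⋆ w) n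
  expand-left = trans (⋆-congˡ w (⋆-leibniz u v) n) (⋆-distribʳ-⊕ w (∂ u ⋆ v) (u ⋆ ∂ v) n)
  collect-right : (u ⋆ (∂ v ⋆ w)) n + (u ⋆ (v ⋆ ∂ w)) n ≡ (u ⋆ ∂ (v ⋆ w)) n
  collect-right = trans (sym (⋆-distribˡ-⊕ u (∂ v ⋆ w) (v ⋆ ∂ w) n)) (⋆-congʳ u (sym ∘ ⋆-leibniz v w) n)

⋆-identityˡ : ∀ u → δ ⋆ u ≗ u
⋆-identityˡ u zero    = trans (⋆-at-0 δ u) (ℚP.*-identityˡ (u 0))
⋆-identityˡ u (suc n) = begin
  (δ ⋆ u) (suc n)              ≡⟨ ⋆-leibniz δ u n ⟩
  (∂ δ ⋆ u) n + (δ ⋆ ∂ u) n    ≡⟨ cong₂ _+_ (trans (⋆-congˡ u ∂-δ n) (⋆-zeroˡ u n)) (⋆-identityˡ (∂ u) n) ⟩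
  0ℚ + u (suc n)               ≡⟨ ℚP.+-identityˡ (u (suc n)) ⟩
  u (suc n)                    ∎
  where open ≡-Reasoning

⋆-identityʳ : ∀ u → u ⋆ δ ≗ u
⋆-identityʳ u n = trans (⋆-comm u δ n) (⋆-identityˡ u n)

⋆-⊖-δ : ∀ u v → u ⋆ (v ⊖ δ) ≗ u ⋆ v ⊖ u
⋆-⊖-δ u v n = trans (⋆-distribˡ-⊖ u v δ n) (cong (_-_ ((u ⋆ v) n)) (⋆-identityʳ u n))

exp-⋆-exp : ∀ x y → exp x ⋆ exp y ≗ exp (x ℕ.+ y)
exp-⋆-exp x y zero    = trans (⋆-at-0 (exp x) (exp y)) (ℚP.*-identityˡ 1ℚ)
exp-⋆-exp x y (suc n) = begin
  (exp x ⋆ exp y) (suc n)                               ≡⟨ ⋆-leibniz (exp x) (exp y) n ⟩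
  (∂ (exp x) ⋆ exp y) n + (exp x ⋆ ∂ (exp y)) n
    ≡⟨ cong₂ _+_ (⋆-congˡ (exp y) (∂-exp x) n) (⋆-congʳ (exp x) (∂-exp y) n) ⟩
  ((ι x · exp x) ⋆ exp y) n + (exp x ⋆ (ι y · exp y)) n
    ≡⟨ cong₂ _+_ (⋆-scalarˡ (exp y) (ι x) (exp x) n) (⋆-scalarʳ (exp x) (ι y) (exp y) n) ⟩
  ι x * (exp x ⋆ exp y) n + ι y * (exp x ⋆ exp y) n     ≡⟨ ℚP.*-distribʳ-+ _ (ι x) (ι y) ⟨
  (ι x + ι y) * (exp x ⋆ exp y) n                       ≡⟨ cong₂ _*_ (ι-homo-+ x y) (sym (exp-⋆-exp x y n)) ⟨
  ι (x ℕ.+ y) * exp (x ℕ.+ y) n                         ≡⟨ ∂-exp (x ℕ.+ y) n ⟨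
  exp (x ℕ.+ y) (suc n)                                 ∎
  where open ≡-Reasoning

∂-linear : ∀ a → ∂ (linear a) ≗ ι a · δ
∂-linear a zero    = sym (ℚP.*-identityʳ (ι a))
∂-linear a (suc n) = sym (ℚP.*-zeroʳ (ι a))

linear-⋆-suc : ∀ a u n → (linear a ⋆ u) (suc n) ≡ ι (suc n) * ι a * u n
linear-⋆-suc a u zero = begin
  (linear a ⋆ u) 1                             ≡⟨ ⋆-leibniz (linear a) u 0 ⟩
  (∂ (linear a) ⋆ u) 0 + (linear a ⋆ ∂ u) 0
    ≡⟨ cong₂ _+_ (⋆-at-0 (∂ (linear a)) u) (trans (⋆-at-0 (linear a) (∂ u)) (ℚP.*-zeroˡ (u 1))) ⟩
  ι a * u 0 + 0ℚ                               ≡⟨ ℚP.+-identityʳ (ι a * u 0) ⟩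
  ι a * u 0                                    ≡⟨ cong (_* u 0) (ℚP.*-identityˡ (ι a)) ⟨
  1ℚ * ι a * u 0                               ∎
  where open ≡-Reasoning
linear-⋆-suc a u (suc n) = begin
  (linear a ⋆ u) (suc (suc n))                           ≡⟨ ⋆-leibniz (linear a) u (suc n) ⟩
  (∂ (linear a) ⋆ u) (suc n) + (linear a ⋆ ∂ u) (suc n)  ≡⟨ cong₂ _+_ derivative-term (linear-⋆-suc a (∂ u) n) ⟩
  ι a * u (suc n) + ι (suc n) * ι a * u (suc n)          ≡⟨ collect (ι a) (u (suc n)) (ι (suc n)) ⟩
  (1ℚ + ι (suc n)) * ι a * u (suc n)
    ≡⟨ cong (λ c → c * ι a * u (suc n)) (ι-homo-+ 1 (suc n)) ⟨
  ι (suc (suc n)) * ι a * u (suc n)                      ∎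
  where
  open ≡-Reasoning
  derivative-term : (∂ (linear a) ⋆ u) (suc n) ≡ ι a * u (suc n)
  derivative-term = trans (⋆-congˡ u (∂-linear a) (suc n))
                          (trans (⋆-scalarˡ u (ι a) δ (suc n)) (cong (ι a *_) (⋆-identityˡ u (suc n))))
  collect : ∀ a x s → a * x + s * a * x ≡ (1ℚ + s) * a * x
  collect = solve-∀ ℚ-ring

linear-⋆-cancel : ∀ a .{{_ : ℕ.NonZero a}} {u v} → linear a ⋆ u ≗ linear a ⋆ v → u ≗ v
linear-⋆-cancel a {u} {v} au≗av n = *-cancelˡ (ι (suc n) * ι a) coefficient≢0 (begin
  ι (suc n) * ι a * u n     ≡⟨ linear-⋆-suc a u n ⟨
  (linear a ⋆ u) (suc n)    ≡⟨ au≗av (suc n) ⟩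
  (linear a ⋆ v) (suc n)    ≡⟨ linear-⋆-suc a v n ⟩
  ι (suc n) * ι a * v n     ∎)
  where
  open ≡-Reasoning
  coefficient≢0 : ι (suc n) * ι a ≢ 0ℚ
  coefficient≢0 = ι-nonZero (suc n ℕ.* a) {{ℕP.m*n≢0 (suc n) a}} ∘ trans (ι-homo-* (suc n) a)

expSum-suc : ∀ b → expSum (suc b) ≗ expSum b ⊕ exp b
expSum-suc b n = ι-homo-+ (sumBelow b (λ k → k ^ n)) (b ^ n)

-- (e^{(b−1)t} + ⋯ + 1) e^t telescopes.
expSum-⋆-exp₁ : ∀ b → expSum b ⋆ exp 1 ≗ expSum b ⊕ exp b ⊖ δ
expSum-⋆-exp₁ zero n = trans (⋆-zeroˡ (exp 1) n) (cancel (δ n))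
  where
  cancel : ∀ x → 0ℚ ≡ 0ℚ + x - x
  cancel = solve-∀ ℚ-ring
expSum-⋆-exp₁ (suc b) n = begin
  (expSum (suc b) ⋆ exp 1) n                         ≡⟨ ⋆-congˡ (exp 1) (expSum-suc b) n ⟩
  ((expSum b ⊕ exp b) ⋆ exp 1) n                     ≡⟨ ⋆-distribʳ-⊕ (exp 1) (expSum b) (exp b) n ⟩
  (expSum b ⋆ exp 1) n + (exp b ⋆ exp 1) n
    ≡⟨ cong₂ _+_ (expSum-⋆-exp₁ b n) (trans (exp-⋆-exp b 1 n) (cong (λ c → exp c n) (ℕP.+-comm b 1))) ⟩
  expSum b n + exp b n - δ n + exp (suc b) n         ≡⟨ reorder (expSum b n) (exp b n) (δ n) (exp (suc b) n) ⟩
  (expSum b n + exp b n) + exp (suc b) n - δ n       ≡⟨ cong (λ x → x + exp (suc b) n - δ n) (expSum-suc b n) ⟨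
  expSum (suc b) n + exp (suc b) n - δ n             ∎
  where
  open ≡-Reasoning
  reorder : ∀ s x d y → s + x - d + y ≡ (s + x) + y - d
  reorder = solve-∀ ℚ-ring

-- (e^{at} − 1)/(a t) = Σ a^n t^n / (n+1)!
κ : ℕ → EGF
κ a n = ι (a ^ n) * 1/ℕ (suc n)

linear-⋆-κ : ∀ a → linear a ⋆ κ a ≗ exp a ⊖ δ
linear-⋆-κ a zero    = trans (⋆-at-0 (linear a) (κ a)) (trans (ℚP.*-zeroˡ (κ a 0)) (sym (ℚP.+-inverseʳ 1ℚ)))
linear-⋆-κ a (suc n) = begin
  (linear a ⋆ κ a) (suc n)                       ≡⟨ linear-⋆-suc a (κ a) n ⟩
  ι (suc n) * ι a * (ι (a ^ n) * 1/ℕ (suc n))    ≡⟨ regroup (ι (suc n)) (ι a) (ι (a ^ n)) (1/ℕ (suc n)) ⟩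
  ι (suc n) * 1/ℕ (suc n) * (ι a * ι (a ^ n))    ≡⟨ cong₂ _*_ (ι*1/ℕ (suc n)) (sym (ι-homo-* a (a ^ n))) ⟩
  1ℚ * exp a (suc n)                             ≡⟨ ℚP.*-identityˡ (exp a (suc n)) ⟩
  exp a (suc n)                                  ≡⟨ ℚP.+-identityʳ (exp a (suc n)) ⟨
  exp a (suc n) - δ (suc n)                      ∎
  where
  open ≡-Reasoning
  regroup : ∀ s x y i → s * x * (y * i) ≡ s * i * (x * y)
  regroup = solve-∀ ℚ-ring

-- The recurrence for the generalized Genocchi numbers

module Recurrence {a : ℕ} .{{_ : ℕ.NonZero a}} {G : EGF} (isG : IsGenocchi a G) where

  linear-⋆-G⋆κ : linear a ⋆ (G ⋆ κ a) ≗ G ⋆ exp a ⊖ G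
  linear-⋆-G⋆κ n = begin
    (linear a ⋆ (G ⋆ κ a)) n    ≡⟨ ⋆-assoc (linear a) G (κ a) n ⟨
    ((linear a ⋆ G) ⋆ κ a) n    ≡⟨ ⋆-congˡ (κ a) (⋆-comm (linear a) G) n ⟩
    ((G ⋆ linear a) ⋆ κ a) n    ≡⟨ ⋆-assoc G (linear a) (κ a) n ⟩
    (G ⋆ (linear a ⋆ κ a)) n    ≡⟨ ⋆-congʳ G (linear-⋆-κ a) n ⟩
    (G ⋆ (exp a ⊖ δ)) n         ≡⟨ ⋆-⊖-δ G (exp a) n ⟩
    (G ⋆ exp a) n - G n         ∎
    where open ≡-Reasoning

  linear-⋆-exp₁⊖δ : linear a ⋆ (exp 1 ⊖ δ) ≗ G ⋆ exp a ⊖ G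
  linear-⋆-exp₁⊖δ n = begin
    (linear a ⋆ (exp 1 ⊖ δ)) n                              ≡⟨ ⋆-⊖-δ (linear a) (exp 1) n ⟩
    (linear a ⋆ exp 1) n - linear a n
      ≡⟨ cong₂ _-_ (⋆-congˡ (exp 1) (sym ∘ isG) n) (sym (isG n)) ⟩
    ((G ⋆ expSum a) ⋆ exp 1) n - S                          ≡⟨ cong (_- S) (⋆-assoc G (expSum a) (exp 1) n) ⟩
    (G ⋆ (expSum a ⋆ exp 1)) n - S                          ≡⟨ cong (_- S) (⋆-congʳ G (expSum-⋆-exp₁ a) n) ⟩
    (G ⋆ (expSum a ⊕ exp a ⊖ δ)) n - S                      ≡⟨ cong (_- S) (⋆-⊖-δ G (expSum a ⊕ exp a) n) ⟩
    (G ⋆ (expSum a ⊕ exp a)) n - G n - S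
      ≡⟨ cong (λ x → x - G n - S) (⋆-distribˡ-⊕ G (expSum a) (exp a) n) ⟩
    S + (G ⋆ exp a) n - G n - S                             ≡⟨ cancel S ((G ⋆ exp a) n) (G n) ⟩
    (G ⋆ exp a) n - G n                                     ∎
    where
    open ≡-Reasoning
    S = (G ⋆ expSum a) n
    cancel : ∀ s x g → s + x - g - s ≡ x - g
    cancel = solve-∀ ℚ-ring

  G⋆κ : G ⋆ κ a ≗ exp 1 ⊖ δ
  G⋆κ = linear-⋆-cancel a (λ n → trans (linear-⋆-G⋆κ n) (sym (linear-⋆-exp₁⊖δ n)))

  term : ℕ → ℕ → ℚ
  term N j = ι (N C j) * (G j * κ a (N ∸ j))

  term-diagonal : ∀ N → term N N ≡ G N
  term-diagonal N = trans (cong₂ (λ c k → ι c * (G N * κ a k)) (nCn≡1 N) (ℕP.n∸n≡0 N)) (unit (G N))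
    where
    unit : ∀ g → 1ℚ * (g * 1ℚ) ≡ g
    unit = solve-∀ ℚ-ring

  G-zero : G 0 ≡ 0ℚ
  G-zero = begin
    G 0            ≡⟨ ℚP.*-identityʳ (G 0) ⟨
    G 0 * 1ℚ       ≡⟨ ⋆-at-0 G (κ a) ⟨
    (G ⋆ κ a) 0    ≡⟨ G⋆κ 0 ⟩
    1ℚ - 1ℚ        ≡⟨ ℚP.+-inverseʳ 1ℚ ⟩
    0ℚ             ∎
    where open ≡-Reasoning

  G-suc : ∀ m → G (suc m) ≡ 1ℚ - sumTo m (term (suc m))
  G-suc m = begin
    G (suc m)                  ≡⟨ add-sub s (G (suc m)) ⟩
    s + G (suc m) - s          ≡⟨ cong (λ x → s + x - s) (term-diagonal (suc m)) ⟨
    (G ⋆ κ a) (suc m) - s      ≡⟨ cong (_- s) (G⋆κ (suc m)) ⟩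
    ι (1 ^ suc m) - 0ℚ - s     ≡⟨ cong (λ k → ι k - 0ℚ - s) (ℕP.^-zeroˡ (suc m)) ⟩
    1ℚ - s                     ∎
    where
    open ≡-Reasoning
    s = sumTo m (term (suc m))
    add-sub : ∀ s g → g ≡ s + g - s
    add-sub = solve-∀ ℚ-ring

-- The ring ℤ₍a₎ of rationals with denominator coprime to a, and its ideal aℤ₍a₎

record Integral (a : ℕ) (q : ℚ) : Set where
  constructor integral
  field
    denominator : ℕ
    coprime     : Coprime denominator a
    numerator   : ℤ
    clears      : q * ι denominator ≡ fromℤ numerator

record Multiple (a : ℕ) (q : ℚ) : Set where
  constructor multiple
  field
    cofactor          : ℚ
    cofactor-integral : Integral a cofactor
    factorises        : q ≡ ι a * cofactor

coprime-* : ∀ {v w a} → Coprime v a → Coprime w a → Coprime (v ℕ.* w) a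
coprime-* {v} cv cw {d} (d∣vw , d∣a) = cw (Coprimality.coprime-divisor d⊥v d∣vw , d∣a)
  where
  d⊥v : Coprime d v
  d⊥v (e∣d , e∣v) = cv (e∣v , ℕ∣.∣-trans e∣d d∣a)

integral-fromℤ : ∀ {a} z → Integral a (fromℤ z)
integral-fromℤ {a} z = integral 1 (Coprimality.1-coprimeTo a) z (ℚP.*-identityʳ (fromℤ z))

integral-ι : ∀ {a} n → Integral a (ι n)
integral-ι n = integral-fromℤ (+ n)

integral-+ : ∀ {a p q} → Integral a p → Integral a q → Integral a (p + q)
integral-+ {p = p} {q} (integral v cv z pv≡z) (integral w cw y qw≡y) =
  integral (v ℕ.* w) (coprime-* cv cw) (z ℤ.* + w ℤ.+ y ℤ.* + v) (begin
    (p + q) * ι (v ℕ.* w)                    ≡⟨ cong ((p + q) *_) (ι-homo-* v w) ⟩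
    (p + q) * (ι v * ι w)                    ≡⟨ expand p q (ι v) (ι w) ⟩
    p * ι v * ι w + q * ι w * ι v            ≡⟨ cong₂ (λ x y → x * ι w + y * ι v) pv≡z qw≡y ⟩
    fromℤ z * ι w + fromℤ y * ι v            ≡⟨ cong₂ _+_ (fromℤ-homo-* z (+ w)) (fromℤ-homo-* y (+ v)) ⟨
    fromℤ (z ℤ.* + w) + fromℤ (y ℤ.* + v)    ≡⟨ fromℤ-homo-+ (z ℤ.* + w) (y ℤ.* + v) ⟨
    fromℤ (z ℤ.* + w ℤ.+ y ℤ.* + v)          ∎)
  where
  open ≡-Reasoning
  expand : ∀ p q v w → (p + q) * (v * w) ≡ p * v * w + q * w * v
  expand = solve-∀ ℚ-ring

integral-* : ∀ {a p q} → Integral a p → Integral a q → Integral a (p * q)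
integral-* {p = p} {q} (integral v cv z pv≡z) (integral w cw y qw≡y) =
  integral (v ℕ.* w) (coprime-* cv cw) (z ℤ.* y) (begin
    p * q * ι (v ℕ.* w)      ≡⟨ cong (p * q *_) (ι-homo-* v w) ⟩
    p * q * (ι v * ι w)      ≡⟨ interchange p q (ι v) (ι w) ⟩
    p * ι v * (q * ι w)      ≡⟨ cong₂ _*_ pv≡z qw≡y ⟩
    fromℤ z * fromℤ y        ≡⟨ fromℤ-homo-* z y ⟨
    fromℤ (z ℤ.* y)          ∎)
  where
  open ≡-Reasoning
  interchange : ∀ p q v w → p * q * (v * w) ≡ p * v * (q * w)
  interchange = solve-∀ ℚ-ring

integral-neg : ∀ {a p} → Integral a p → Integral a (- p)
integral-neg {p = p} Ip = subst (Integral _) (neg-as-product p) (integral-* (integral-fromℤ ℤ.-1ℤ) Ip)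
  where
  neg-as-product : ∀ p → - 1ℚ * p ≡ - p
  neg-as-product = solve-∀ ℚ-ring

multiple-+ : ∀ {a p q} → Multiple a p → Multiple a q → Multiple a (p + q)
multiple-+ {a} (multiple r Ir refl) (multiple s Is refl) =
  multiple (r + s) (integral-+ Ir Is) (sym (ℚP.*-distribˡ-+ (ι a) r s))

multiple-neg : ∀ {a p} → Multiple a p → Multiple a (- p)
multiple-neg {a} (multiple r Ir refl) = multiple (- r) (integral-neg Ir) (ℚP.neg-distribʳ-* (ι a) r)

multiple-− : ∀ {a p q} → Multiple a p → Multiple a q → Multiple a (p - q)
multiple-− Mp Mq = multiple-+ Mp (multiple-neg Mq)

multiple-*ˡ : ∀ {a p q} → Integral a p → Multiple a q → Multiple a (p * q)
multiple-*ˡ {a} {p} Ip (multiple r Ir refl) =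
  multiple (p * r) (integral-* Ip Ir) (swap p (ι a) r)
  where
  swap : ∀ p a r → p * (a * r) ≡ a * (p * r)
  swap = solve-∀ ℚ-ring

multiple⇒integral : ∀ {a q} → Multiple a q → Integral a q
multiple⇒integral {a} (multiple r Ir refl) = integral-* (integral-ι a) Ir

-- A numerator is read off q v = a z with v coprime to a, so a divides it.
multiple⇒∣↥ : ∀ {a q} → Multiple a q → + a ∣ℤ ↥ q
multiple⇒∣↥ {a} {q@(mkℚ n d-1 _)} (multiple r (integral v cv z rv≡z) q≡ar) =
  Coprimality.coprime-divisor (Coprimality.sym cv) (subst (a ∣_) (ℕP.*-comm ℤ.∣ n ∣ v) a∣nv)
  where
  qv≡az : q * ι v ≡ fromℤ (+ a ℤ.* z)
  qv≡az = begin
    q * ι v            ≡⟨ cong (_* ι v) q≡ar ⟩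
    ι a * r * ι v      ≡⟨ ℚP.*-assoc (ι a) r (ι v) ⟩
    ι a * (r * ι v)    ≡⟨ cong (ι a *_) rv≡z ⟩
    ι a * fromℤ z      ≡⟨ fromℤ-homo-* (+ a) z ⟨
    fromℤ (+ a ℤ.* z)  ∎
    where open ≡-Reasoning
  cross-multiplied : (n ℤ.* + v) ℤ.* + 1 ≡ (+ a ℤ.* z) ℤ.* + (suc d-1 ℕ.* 1)
  cross-multiplied with ℚᵘP.≃-trans (ℚᵘP.*-cong (ℚᵘP.≃-refl {toℚᵘ q}) (ℚᵘP.≃-sym (toℚᵘ-fromℤ (+ v))))
                          (ℚᵘP.≃-trans (ℚᵘP.≃-sym (ℚP.toℚᵘ-homo-* q (ι v)))
                            (ℚᵘP.≃-trans (ℚᵘP.≃-reflexive (cong toℚᵘ qv≡az)) (toℚᵘ-fromℤ (+ a ℤ.* z))))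
  ... | ℚᵘ.*≡* eq = eq
  a∣nv : a ∣ ℤ.∣ n ∣ ℕ.* v
  a∣nv = divides (ℤ.∣ z ∣ ℕ.* suc d-1) (begin
    ℤ.∣ n ∣ ℕ.* v                                ≡⟨ ℤP.abs-* n (+ v) ⟨
    ℤ.∣ n ℤ.* + v ∣                              ≡⟨ cong ℤ.∣_∣ (ℤP.*-identityʳ (n ℤ.* + v)) ⟨
    ℤ.∣ (n ℤ.* + v) ℤ.* + 1 ∣                    ≡⟨ cong ℤ.∣_∣ cross-multiplied ⟩
    ℤ.∣ (+ a ℤ.* z) ℤ.* + (suc d-1 ℕ.* 1) ∣      ≡⟨ ℤP.abs-* (+ a ℤ.* z) _ ⟩
    ℤ.∣ + a ℤ.* z ∣ ℕ.* (suc d-1 ℕ.* 1)          ≡⟨ cong₂ ℕ._*_ (ℤP.abs-* (+ a) z) (ℕP.*-identityʳ (suc d-1)) ⟩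
    a ℕ.* ℤ.∣ z ∣ ℕ.* suc d-1                    ≡⟨ rotate a ℤ.∣ z ∣ (suc d-1) ⟩
    ℤ.∣ z ∣ ℕ.* suc d-1 ℕ.* a                    ∎)
    where
    open ≡-Reasoning
    rotate : ∀ x y w → x ℕ.* y ℕ.* w ≡ y ℕ.* w ℕ.* x
    rotate = ℕ-solve-∀

sumTo-integral : ∀ {a} n {f} → (∀ j → j ≤ n → Integral a (f j)) → Integral a (sumTo n f)
sumTo-integral = sumTo-closed (Integral _) integral-+

sumTo-multiple : ∀ {a} n {f} → (∀ j → j ≤ n → Multiple a (f j)) → Multiple a (sumTo n f)
sumTo-multiple = sumTo-closed (Multiple _) multiple-+

PowerCofactor : ℕ → ℕ → Set
PowerCofactor a M = ∃₂ λ k v → Coprime v a × M ∣ a ^ k ℕ.* v × 2 ^ k ≤ M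

-- Split off gcd (M, a) > 1 repeatedly; every split at least halves M.
power-cofactor : ∀ a M → M ≢ 0 → PowerCofactor a M
power-cofactor a = <-rec (λ M → M ≢ 0 → PowerCofactor a M) split
  where
  split : ∀ M → (∀ {q} → q < M → q ≢ 0 → PowerCofactor a q) → M ≢ 0 → PowerCofactor a M
  split M rec M≢0 with gcd M a ℕP.≟ 1
  ... | yes gcd≡1 = 0 , M , Coprimality.gcd≡1⇒coprime gcd≡1 , ℕ∣.∣-reflexive (sym (ℕP.*-identityˡ M))
                  , ℕP.n≢0⇒n>0 M≢0
  ... | no gcd≢1 with gcd[m,n]∣m M a
  ...   | divides q M≡q*g = extend (rec q<M q≢0)
    where
    g = gcd M a
    g≥2 : 2 ≤ g
    g≥2 = ℕP.≤∧≢⇒< (ℕP.n≢0⇒n>0 (gcd[m,n]≢0 M a (inj₁ M≢0))) (gcd≢1 ∘ sym)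
    q≢0 : q ≢ 0
    q≢0 refl = M≢0 M≡q*g
    q<M : q < M
    q<M = subst (q <_) (sym M≡q*g) (ℕP.m<m*n q g {{ℕ.≢-nonZero q≢0}} g≥2)
    extend : PowerCofactor a q → PowerCofactor a M
    extend (k , v , cv , q∣a^k*v , 2^k≤q) = suc k , v , cv , M∣a^[1+k]*v , 2^[1+k]≤M
      where
      rotate : ∀ x y z → x ℕ.* y ℕ.* z ≡ z ℕ.* x ℕ.* y
      rotate = ℕ-solve-∀
      M∣a^[1+k]*v : M ∣ a ^ suc k ℕ.* v
      M∣a^[1+k]*v = subst₂ _∣_ (sym M≡q*g) (rotate (a ^ k) v a) (ℕ∣.*-pres-∣ q∣a^k*v (gcd[m,n]∣n M a))
      2^[1+k]≤M : 2 ^ suc k ≤ M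
      2^[1+k]≤M = subst (2 ^ suc k ≤_) (trans (ℕP.*-comm g q) (sym M≡q*g)) (ℕP.*-mono-≤ g≥2 2^k≤q)

integral-/ : ∀ {a} b M .{{_ : ℕ.NonZero M}} {v} → Coprime v a → M ∣ b ℕ.* v → Integral a (ι b * 1/ℕ M)
integral-/ b M {v} cv (divides w bv≡wM) = integral v cv (+ w) (begin
  ι b * 1/ℕ M * ι v      ≡⟨ swap (ι b) (1/ℕ M) (ι v) ⟩
  ι b * ι v * 1/ℕ M      ≡⟨ cong (_* 1/ℕ M) (trans (sym (ι-homo-* b v)) (trans (cong ι bv≡wM) (ι-homo-* w M))) ⟩
  ι w * ι M * 1/ℕ M      ≡⟨ ℚP.*-assoc (ι w) (ι M) (1/ℕ M) ⟩
  ι w * (ι M * 1/ℕ M)    ≡⟨ cong (ι w *_) (ι*1/ℕ M) ⟩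
  ι w * 1ℚ               ≡⟨ ℚP.*-identityʳ (ι w) ⟩
  ι w                    ∎)
  where
  open ≡-Reasoning
  swap : ∀ x y z → x * y * z ≡ x * z * y
  swap = solve-∀ ℚ-ring

integral-a^e/M : ∀ {a} e M .{{_ : ℕ.NonZero M}} → M < 2 ^ suc e → Integral a (ι (a ^ e) * 1/ℕ M)
integral-a^e/M {a} e M M<2^[1+e] with power-cofactor a M (ℕ.≢-nonZero⁻¹ M)
... | k , v , cv , M∣a^k*v , 2^k≤M = integral-/ (a ^ e) M cv (ℕ∣.∣-trans M∣a^k*v (ℕ∣.*-monoˡ-∣ v a^k∣a^e))
  where
  k≤e : k ≤ e
  k≤e = ℕP.≮⇒≥ λ e<k → ℕP.<⇒≱ M<2^[1+e] (ℕP.≤-trans (ℕP.^-monoʳ-≤ 2 e<k) 2^k≤M)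
  a^k∣a^e : a ^ k ∣ a ^ e
  a^k∣a^e = divides (a ^ (e ∸ k)) (trans (cong (a ^_) (sym (ℕP.m∸n+n≡m k≤e))) (ℕP.^-distribˡ-+-* a (e ∸ k) k))

3+n<2^[2+n] : ∀ n → 3 ℕ.+ n < 2 ^ (2 ℕ.+ n)
3+n<2^[2+n] zero    = ℕP.≤-refl
3+n<2^[2+n] (suc n) = ℕP.≤-<-trans (3+n<2^[2+n] n) (ℕP.^-monoʳ-< 2 ℕP.≤-refl (ℕP.n<1+n (2 ℕ.+ n)))

integral-κ₁ : ∀ {a} → Integral a (κ a 1)
integral-κ₁ = integral-a^e/M 1 2 (ℕP.m≤n⇒m≤1+n ℕP.≤-refl)

multiple-κ : ∀ {a} c → Multiple a (κ a (2 ℕ.+ c))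
multiple-κ {a} c = multiple (ι (a ^ suc c) * 1/ℕ (3 ℕ.+ c)) (integral-a^e/M (suc c) (3 ℕ.+ c) (3+n<2^[2+n] c))
  (trans (cong (_* 1/ℕ (3 ℕ.+ c)) (ι-homo-* a (a ^ suc c))) (ℚP.*-assoc (ι a) _ _))

integral-κ : ∀ {a} k → Integral a (κ a k)
integral-κ zero          = integral-a^e/M 0 1 ℕP.≤-refl
integral-κ (suc zero)    = integral-κ₁
integral-κ (suc (suc c)) = multiple⇒integral (multiple-κ c)

κ₁≡a*½ : ∀ a → κ a 1 ≡ ι a * 1/ℕ 2
κ₁≡a*½ a = cong (λ x → ι x * 1/ℕ 2) (ℕP.*-identityʳ a)

2*κ₁*κ₁ : ∀ a → ι 2 * (κ a 1 * κ a 1) ≡ ι a * κ a 1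
2*κ₁*κ₁ a = begin
  ι 2 * (κ a 1 * κ a 1)                       ≡⟨ cong (λ x → ι 2 * (x * x)) (κ₁≡a*½ a) ⟩
  ι 2 * (ι a * 1/ℕ 2 * (ι a * 1/ℕ 2))         ≡⟨ regroup (ι 2) (ι a) (1/ℕ 2) ⟩
  ι a * (ι a * 1/ℕ 2) * (ι 2 * 1/ℕ 2)         ≡⟨ cong₂ (λ x y → ι a * x * y) (sym (κ₁≡a*½ a)) (ι*1/ℕ 2) ⟩
  ι a * κ a 1 * 1ℚ                            ≡⟨ ℚP.*-identityʳ (ι a * κ a 1) ⟩
  ι a * κ a 1                                 ∎
  where
  open ≡-Reasoning
  regroup : ∀ t a h → t * (a * h * (a * h)) ≡ a * (a * h) * (t * h)
  regroup = solve-∀ ℚ-ring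

pronic-even : ∀ n → ∃ λ t → suc n ℕ.* n ≡ t ℕ.* 2
pronic-even zero    = 0 , refl
pronic-even (suc n) with pronic-even n
... | t , [1+n]n≡2t = t ℕ.+ suc n , (begin
  suc (suc n) ℕ.* suc n          ≡⟨ expand n ⟩
  suc n ℕ.* n ℕ.+ 2 ℕ.* suc n    ≡⟨ cong (ℕ._+ 2 ℕ.* suc n) [1+n]n≡2t ⟩
  t ℕ.* 2 ℕ.+ 2 ℕ.* suc n        ≡⟨ collect t (suc n) ⟩
  (t ℕ.+ suc n) ℕ.* 2            ∎)
  where
  open ≡-Reasoning
  expand : ∀ n → suc (suc n) ℕ.* suc n ≡ suc n ℕ.* n ℕ.+ 2 ℕ.* suc n
  expand = ℕ-solve-∀
  collect : ∀ t m → t ℕ.* 2 ℕ.+ 2 ℕ.* m ≡ (t ℕ.+ m) ℕ.* 2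
  collect = ℕ-solve-∀

module Congruence {a : ℕ} .{{_ : ℕ.NonZero a}} {G : EGF} (isG : IsGenocchi a G) where
  open Recurrence {G = G} isG

  G-integral : ∀ n → Integral a (G n)
  G-integral = <-rec (Integral a ∘ G) integral-at
    where
    integral-at : ∀ n → (∀ {j} → j < n → Integral a (G j)) → Integral a (G n)
    integral-at zero    _  = subst (Integral a) (sym G-zero) (integral-ι 0)
    integral-at (suc m) ih = subst (Integral a) (sym (G-suc m))
      (integral-+ (integral-ι 1) (integral-neg (sumTo-integral m λ j j≤m →
        integral-* (integral-ι (suc m C j)) (integral-* (ih (s≤s j≤m)) (integral-κ (suc m ∸ j))))))

  G-one : G 1 ≡ 1ℚ
  G-one = trans (G-suc 0) (trans (cong (λ g → 1ℚ - 1ℚ * (g * κ a 1)) G-zero) (vanish (κ a 1)))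
    where
    vanish : ∀ k → 1ℚ - 1ℚ * (0ℚ * k) ≡ 1ℚ
    vanish = solve-∀ ℚ-ring

  term-subdiagonal : ∀ m → term (2 ℕ.+ m) (suc m) ≡ ι (2 ℕ.+ m) * (G (suc m) * κ a 1)
  term-subdiagonal m = cong₂ (λ c k → ι c * (G (suc m) * κ a k)) C[2+m,1+m]≡2+m [2+m]∸[1+m]≡1
    where
    [2+m]∸[1+m]≡1 : 2 ℕ.+ m ∸ suc m ≡ 1
    [2+m]∸[1+m]≡1 = ℕP.m+n∸n≡m 1 m
    C[2+m,1+m]≡2+m : (2 ℕ.+ m) C suc m ≡ 2 ℕ.+ m
    C[2+m,1+m]≡2+m = trans (nCk≡nC[n∸k] (ℕP.n≤1+n (suc m)))
                           (trans (cong ((2 ℕ.+ m) C_) [2+m]∸[1+m]≡1) (nC1≡n (2 ℕ.+ m)))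

  G-suc-suc : ∀ m → Multiple a (G (2 ℕ.+ m) - (1ℚ - ι (2 ℕ.+ m) * (G (suc m) * κ a 1)))
  G-suc-suc m = subst (Multiple a) (sym G[2+m]-[1-x]≡-s) (multiple-neg (sumTo-multiple m λ j j≤m →
    multiple-*ˡ (integral-ι ((2 ℕ.+ m) C j)) (multiple-*ˡ (G-integral j) (multiple-κ-at j j≤m))))
    where
    open ≡-Reasoning
    s = sumTo m (term (2 ℕ.+ m))
    x = ι (2 ℕ.+ m) * (G (suc m) * κ a 1)
    multiple-κ-at : ∀ j → j ≤ m → Multiple a (κ a (2 ℕ.+ m ∸ j))
    multiple-κ-at j j≤m = subst (Multiple a ∘ κ a) (sym (ℕP.+-∸-assoc 2 j≤m)) (multiple-κ (m ∸ j))
    cancel : ∀ s x → 1ℚ - (s + x) - (1ℚ - x) ≡ - s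
    cancel = solve-∀ ℚ-ring
    G[2+m]-[1-x]≡-s : G (2 ℕ.+ m) - (1ℚ - x) ≡ - s
    G[2+m]-[1-x]≡-s = begin
      G (2 ℕ.+ m) - (1ℚ - x)                           ≡⟨ cong (_- (1ℚ - x)) (G-suc (suc m)) ⟩
      1ℚ - (s + term (2 ℕ.+ m) (suc m)) - (1ℚ - x)
        ≡⟨ cong (λ y → 1ℚ - (s + y) - (1ℚ - x)) (term-subdiagonal m) ⟩
      1ℚ - (s + x) - (1ℚ - x)                          ≡⟨ cancel s x ⟩
      - s                                              ∎

  congruence : ∀ m → Multiple a (G (2 ℕ.+ m) - (1ℚ - ι (2 ℕ.+ m) * κ a 1))
  congruence zero = subst (λ y → Multiple a (G 2 - (1ℚ - ι 2 * y)))
    (trans (cong (_* κ a 1) G-one) (ℚP.*-identityˡ (κ a 1))) (G-suc-suc 0)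
  congruence (suc m) with pronic-even (2 ℕ.+ m)
  ... | t , NN′≡2t = subst (Multiple a) (sym split)
    (multiple-+ (multiple-− (G-suc-suc (suc m)) (multiple-*ˡ (integral-* (integral-ι N) integral-κ₁) (congruence m)))
                (multiple (ι t * h) (integral-* (integral-ι t) integral-κ₁) refl))
    where
    open ≡-Reasoning
    N′ = 2 ℕ.+ m
    N = suc N′
    h = κ a 1
    g = G N′
    R = G N - (1ℚ - ι N * (g * h))
    D = g - (1ℚ - ι N′ * h)
    regroup : ∀ G g n n′ h →
      G - (1ℚ - n * h) ≡ G - (1ℚ - n * (g * h)) - n * h * (g - (1ℚ - n′ * h)) + n * n′ * (h * h)
    regroup = solve-∀ ℚ-ring
    swap : ∀ t a h → t * (a * h) ≡ a * (t * h)
    swap = solve-∀ ℚ-ring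
    pronic-term : ι N * ι N′ * (h * h) ≡ ι a * (ι t * h)
    pronic-term = begin
      ι N * ι N′ * (h * h)    ≡⟨ cong (_* (h * h)) (ι-homo-* N N′) ⟨
      ι (N ℕ.* N′) * (h * h)  ≡⟨ cong (λ k → ι k * (h * h)) NN′≡2t ⟩
      ι (t ℕ.* 2) * (h * h)   ≡⟨ cong (_* (h * h)) (ι-homo-* t 2) ⟩
      ι t * ι 2 * (h * h)     ≡⟨ ℚP.*-assoc (ι t) (ι 2) (h * h) ⟩
      ι t * (ι 2 * (h * h))   ≡⟨ cong (ι t *_) (2*κ₁*κ₁ a) ⟩
      ι t * (ι a * h)         ≡⟨ swap (ι t) (ι a) h ⟩
      ι a * (ι t * h)         ∎
    split : G N - (1ℚ - ι N * h) ≡ R - ι N * h * D + ι a * (ι t * h)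
    split = trans (regroup (G N) g (ι N) (ι N′) h) (cong (_+_ (R - ι N * h * D)) pronic-term)

theorem2p3 : (a n : ℕ) → a ≥ 2 → n ≥ 2 → (G : ℕ → ℚ) → IsGenocchi a G →
    G n ≡ 1ℚ - ((+ n / 2) * ι a) [mod a ]
theorem2p3 a (suc (suc m)) a≥2 (s≤s (s≤s _)) G isG =
  multiple⇒∣↥ (subst (λ x → Multiple a (G n - (1ℚ - x))) (sym n/2*a≡n*κ₁) (congruence m))
  where
  instance
    a≢0 : ℕ.NonZero a
    a≢0 = ℕ.>-nonZero (ℕP.<-≤-trans (s≤s z≤n) a≥2)
  open Congruence {G = G} isG
  n = 2 ℕ.+ m
  reassociate : ∀ x y z → x * y * z ≡ x * (z * y)
  reassociate = solve-∀ ℚ-ring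
  n/2*a≡n*κ₁ : (+ n / 2) * ι a ≡ ι n * κ a 1
  n/2*a≡n*κ₁ = begin
    (+ n / 2) * ι a          ≡⟨ cong (_* ι a) (+/≡ι*1/ℕ n 2) ⟩
    ι n * 1/ℕ 2 * ι a        ≡⟨ reassociate (ι n) (1/ℕ 2) (ι a) ⟩
    ι n * (ι a * 1/ℕ 2)      ≡⟨ cong (ι n *_) (κ₁≡a*½ a) ⟨
    ι n * κ a 1              ∎
    where open ≡-Reasoning
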